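{- Let $H$ be an even $3$--hypergraph. Then $\chi(H)\leq \chi(\mathrm{link}_H(v))$ for every $v\in V(H)$.
   Context: A $3$--hypergraph $H$ has a finite vertex set $V(H)$ and edge set $E(H)\subseteq\binom{V(H)}{3}$; $\chi(H)$ is the minimum number of classes in a partition of $V(H)$ with no edge inside a single class. $H$ is even if every $4$-element subset of $V(H)$ contains an even number of edges of $H$. For $v\in V(H)$, $\mathrm{link}_H(v)$ is the simple graph with vertex set $\{w\neq v : \{v,w\}\subset e \text{ for some } e\in E(H)\}$ and edge set $\{\{u,w\}: \{v,u,w\}\in E(H)\}$; $\chi$ of a graph is its usual chromatic number. -}

module Defs where

open import Data.Nat using (ℕ; _+_; _%_)
open import Data.Bool using (Bool; true; false)
open import Data.Fin using (Fin)
open import Data.List using (List; _∷_; []; allFin)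
open import Data.Bool.ListAction using (any)
open import Data.Product using (Σ; _×_; ∃)
open import Relation.Binary.PropositionalEquality using (_≡_; _≢_)
open import Relation.Nullary using (¬_)

-- A 3-hypergraph on vertex set Fin n, with edge set given by its
-- indicator function on ordered triples; the indicator is symmetric
-- and only true on triples of pairwise distinct vertices, so it
-- represents exactly a set of 3-element subsets of Fin n.
record Hypergraph3 : Set where
  field
    n        : ℕ
    E        : Fin n → Fin n → Fin n → Bool
    distinct : ∀ a b c → E a b c ≡ true → a ≢ b × a ≢ c × b ≢ c
    sym₁₂    : ∀ a b c → E a b c ≡ E b a c
    sym₂₃    : ∀ a b c → E a b c ≡ E a c b

open Hypergraph3 public

b2n : Bool → ℕ
b2n true  = 1
b2n false = 0

IsEven : Hypergraph3 → Set
IsEven H = ∀ (a b c d : Fin (n H)) →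
  a ≢ b → a ≢ c → a ≢ d → b ≢ c → b ≢ d → c ≢ d →
  (b2n (E H a b c) + b2n (E H a b d) + b2n (E H a c d) + b2n (E H b c d)) % 2 ≡ 0

Colorable : Hypergraph3 → ℕ → Set
Colorable H k = Σ (Fin (n H) → Fin k) λ col →
  ∀ a b c → E H a b c ≡ true → ¬ (col a ≡ col b × col b ≡ col c)

inLink : (H : Hypergraph3) → Fin (n H) → Fin (n H) → Bool
inLink H v w = any (λ u → E H v w u) (allFin (n H))

LinkVertex : (H : Hypergraph3) → Fin (n H) → Set
LinkVertex H v = Σ (Fin (n H)) λ w → inLink H v w ≡ true

-- proper k-colouring of the graph link_H(v) (vertex set LinkVertex H v,
-- edges {u,w} with {v,u,w} ∈ E(H))
LinkColorable : (H : Hypergraph3) → Fin (n H) → ℕ → Set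
LinkColorable H v k = Σ (LinkVertex H v → Fin k) λ col →
  ∀ (x y : LinkVertex H v) → E H v (Σ.proj₁ x) (Σ.proj₁ y) ≡ true → col x ≢ col y

NonIsolated : (H : Hypergraph3) → Fin (n H) → Set
NonIsolated H v = ∃ λ a → ∃ λ b → E H v a b ≡ true

-- Every edge {a,b,c} of an even H has two vertices that are adjacent in
-- link_H(v): if v ∈ {a,b,c} the other two are, and otherwise the four-set
-- {v,a,b,c} contains the edge {a,b,c}, hence by evenness a second edge, which
-- must contain v. So any proper colouring of link_H(v), extended arbitrarily to
-- the remaining vertices, leaves no edge of H monochromatic.
module Submission where

open import Defs
open import Data.Nat using (ℕ; _+_; _%_)
open import Data.Fin using (Fin)
open import Data.Fin.Properties using () renaming (_≟_ to _≟ᶠ_)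
open import Data.Bool using (true; false)
open import Data.Bool.Properties using (T-≡) renaming (_≟_ to _≟ᵇ_)
open import Data.List.Membership.Propositional using (lose)
open import Data.List.Membership.Propositional.Properties using (∈-allFin)
open import Data.List.Relation.Unary.Any.Properties using (any⁺)
open import Data.Product using (Σ; _×_; _,_)
open import Data.Sum using (_⊎_; inj₁; inj₂)
open import Function.Bundles using (Equivalence)
open import Relation.Nullary using (¬_; yes; no; contradiction)
open import Relation.Binary.PropositionalEquality
open import Axiom.UniquenessOfIdentityProofs using (module Decidable⇒UIP)

even-with-true⇒another-true : ∀ x y z →
  (b2n x + b2n y + b2n z + b2n true) % 2 ≡ 0 → x ≡ true ⊎ y ≡ true ⊎ z ≡ true
even-with-true⇒another-true true  _     _     _ = inj₁ refl
even-with-true⇒another-true false true  _     _ = inj₂ (inj₁ refl)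
even-with-true⇒another-true false false true  _ = inj₂ (inj₂ refl)
even-with-true⇒another-true false false false ()

module _ (H : Hypergraph3) where

  edge-inLink : ∀ {v w u} → E H v w u ≡ true → inLink H v w ≡ true
  edge-inLink {v} {w} {u} e =
    Equivalence.to T-≡ (any⁺ (E H v w) (lose (∈-allFin u) (Equivalence.from T-≡ e)))

  IsEven⇒link-edge-in-edge : IsEven H → ∀ v {a b c} → E H a b c ≡ true →
    E H v a b ≡ true ⊎ E H v a c ≡ true ⊎ E H v b c ≡ true
  IsEven⇒link-edge-in-edge even v {a} {b} {c} e with v ≟ᶠ a | v ≟ᶠ b | v ≟ᶠ c
  ... | yes refl | _ | _ = inj₂ (inj₂ e)
  ... | no _ | yes refl | _ = inj₂ (inj₁ (trans (sym₁₂ H v a c) e))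
  ... | no _ | no _ | yes refl = inj₁ (trans (sym₁₂ H v a b) (trans (sym₂₃ H a v b) e))
  ... | no v≢a | no v≢b | no v≢c with distinct H a b c e
  ...   | a≢b , a≢c , b≢c =
    even-with-true⇒another-true (E H v a b) (E H v a c) (E H v b c)
      (subst (λ t → (b2n (E H v a b) + b2n (E H v a c) + b2n (E H v b c) + b2n t) % 2 ≡ 0)
             e (even v a b c v≢a v≢b v≢c a≢b a≢c b≢c))

  module _ {k : ℕ} (v : Fin (n H)) (col : LinkVertex H v → Fin k) (c₀ : Fin k) where

    extendColouring : Fin (n H) → Fin k
    extendColouring w with inLink H v w ≟ᵇ true
    ... | yes onLink = col (w , onLink)
    ... | no _       = c₀

    extendColouring-onLink : ∀ w (p : inLink H v w ≡ true) → extendColouring w ≡ col (w , p)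
    extendColouring-onLink w p with inLink H v w ≟ᵇ true
    ... | yes onLink = cong (λ q → col (w , q)) (Decidable⇒UIP.≡-irrelevant _≟ᵇ_ onLink p)
    ... | no offLink = contradiction p offLink

    extendColouring-proper :
      (∀ (x y : LinkVertex H v) → E H v (Σ.proj₁ x) (Σ.proj₁ y) ≡ true → col x ≢ col y) →
      ∀ {x y} → E H v x y ≡ true → extendColouring x ≢ extendColouring y
    extendColouring-proper proper {x} {y} e same =
      proper (x , px) (y , py) e (begin
        col (x , px)       ≡⟨ sym (extendColouring-onLink x px) ⟩
        extendColouring x  ≡⟨ same ⟩
        extendColouring y  ≡⟨ extendColouring-onLink y py ⟩
        col (y , py)       ∎)
      where
      open ≡-Reasoning
      px : inLink H v x ≡ true
      px = edge-inLink e
      py : inLink H v y ≡ true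
      py = edge-inLink (trans (sym₂₃ H v y x) e)

lemma1 : (H : Hypergraph3) → IsEven H → (v : Fin (n H)) → NonIsolated H v →
    (k : ℕ) → LinkColorable H v k → Colorable H k
lemma1 H even v (a , b , e) k (col , col-proper) = colour , colour-proper
  where
  colour : Fin (n H) → Fin k
  colour = extendColouring H v col (col (a , edge-inLink H e))

  colour-proper : ∀ x y z → E H x y z ≡ true → ¬ (colour x ≡ colour y × colour y ≡ colour z)
  colour-proper x y z exyz (x≡y , y≡z) with IsEven⇒link-edge-in-edge H even v exyz
  ... | inj₁ evxy        = extendColouring-proper H v col _ col-proper evxy x≡y
  ... | inj₂ (inj₁ evxz) = extendColouring-proper H v col _ col-proper evxz (trans x≡y y≡z)
  ... | inj₂ (inj₂ evyz) = extendColouring-proper H v col _ col-proper evyz y≡z
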